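{- Let $r$ and $s$ be positive integers with $r \geq s \geq 2$ and $r \leq 2s - 2$. Then $f(s,r,2) = 4s + r - 3$.
   Context: For integers $a\le b$, $[a,b]=\{n\in\mathbb{N} : a\le n\le b\}$. For a finite set $X\subseteq\mathbb{N}$, $\mathrm{diam}(X)=\max(X)-\min(X)$. A set is monochromatic under a coloring $\Delta$ if all its elements receive the same color. For positive integers $s,r,k$, $f(s,r,k)$ denotes the smallest positive integer $n$ such that for every coloring $\Delta:[1,n]\to\{1,\dots,k\}$ there exist subsets $S_1,S_2\subseteq[1,n]$ with: (a) $S_1$ and $S_2$ each monochromatic (not necessarily of the same color); (b) $|S_1|=s$, $|S_2|=r$; (c) $\max(S_1)<\min(S_2)$; (d) $\mathrm{diam}(S_1)\le\mathrm{diam}(S_2)$. -}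

module Defs where

open import Data.Nat using (ℕ; zero; suc; _+_; _∸_; _≤_; _<_; _⊔_; _⊓_)
open import Data.Fin using (Fin)
open import Data.Empty using (⊥)
open import Data.List using (List; []; _∷_; length)
open import Data.List.Relation.Unary.All using (All)
open import Data.List.Relation.Unary.Unique.Propositional using (Unique)
open import Data.Product using (Σ; _×_; ∃)
open import Relation.Binary.PropositionalEquality using (_≡_)

-- A finite subset of ℕ is represented by a duplicate-free list of its elements.

-- Maximum and minimum of a list (only used for nonempty lists; the empty
-- list gets the dummy value 0).
maxL : List ℕ → ℕ
maxL []       = 0
maxL (x ∷ xs) = go x xs
  where
  go : ℕ → List ℕ → ℕ
  go m []       = m
  go m (y ∷ ys) = go (m ⊔ y) ys

minL : List ℕ → ℕ
minL []       = 0
minL (x ∷ xs) = go x xs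
  where
  go : ℕ → List ℕ → ℕ
  go m []       = m
  go m (y ∷ ys) = go (m ⊓ y) ys

diam : List ℕ → ℕ
diam X = maxL X ∸ minL X

InInterval : ℕ → List ℕ → Set
InInterval n X = All (λ x → 1 ≤ x × x ≤ n) X

Monochromatic : {k : ℕ} → (ℕ → Fin k) → List ℕ → Set
Monochromatic {k} Δ X = Σ (Fin k) λ c → All (λ x → Δ x ≡ c) X

GoodSet : {k : ℕ} → (ℕ → Fin k) → ℕ → ℕ → List ℕ → Set
GoodSet Δ n m S = Unique S × InInterval n S × length S ≡ m × Monochromatic Δ S

-- Colorings Δ : [1,n] → {1..k} are represented by functions ℕ → Fin k;
-- only the values on [1,n] are relevant, since all sets used lie in [1,n].
HasPattern : ℕ → ℕ → ℕ → ℕ → Set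
HasPattern s r k n =
  (Δ : ℕ → Fin k) →
  Σ (List ℕ) λ S₁ → Σ (List ℕ) λ S₂ →
    GoodSet Δ n s S₁ × GoodSet Δ n r S₂ ×
    maxL S₁ < minL S₂ × diam S₁ ≤ diam S₂

fIs : ℕ → ℕ → ℕ → ℕ → Set
fIs s r k n =
  1 ≤ n × HasPattern s r k n × ((m : ℕ) → 1 ≤ m → m < n → HasPattern s r k m → ⊥)

{-# OPTIONS --safe #-}
-- Write s = k + 1, A = 2k and n = 4s + r − 3 = (A + 1) + (A + r).
--
-- Upper bound.  Among the points 1 … A + 1 some colour occurs s times, giving S₁ with
-- diam S₁ ≤ A.  Let Y be the colour of n and look at the block A + 2 … n.  If the other
-- colour occurs A + 1 times there, or Y occurs r times there with a Y-point ≤ n − A, that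
-- colour class has diameter ≥ A, and so has an r-subset S₂ of diameter ≥ A (keep its least
-- and greatest points).  Otherwise A + 2 … n − A carries no Y-point: its first s points
-- form S₁ with diameter s − 1, and any r Y-points of the block form S₂ with diameter ≥ r − 1.
--
-- Lower bound.  Colour 1 … n − 1 as R^k B^k R^(A+1) B^(r−1).  The first A points hold at
-- most k points of each colour, so max S₁ > A; then S₂ is too large for the last blue
-- block, hence red and inside the long red block, which forces S₁ to be red too.  If S₁
-- starts in the first red block, its s points fit into [min S₁, k] ∪ [A + 1, max S₁],
-- whence diam S₁ ≥ A > diam S₂.  Otherwise S₁ and S₂ both lie in the long red block,
-- which has only A + 1 < s + r points.
module Submission where

open import Defs

open import Data.Nat using (ℕ; zero; suc; _+_; _*_; _∸_; _≤_; _<_; _⊔_; _⊓_; z≤n; s≤s; s≤s⁻¹)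
open import Data.Nat.Properties
open import Data.Nat.Tactic.RingSolver using (solve-∀)
open import Data.Fin using (Fin; zero; suc; opposite)
open import Data.Fin.Properties using () renaming (_≟_ to _≟ᶠ_)
open import Data.List using (List; []; _∷_; _++_; length; filter; applyUpTo; take; drop)
open import Data.List.Properties using (length-applyUpTo; length-++; length-take; length-drop; filter-notAll)
open import Data.List.Relation.Unary.All using (All; []; _∷_)
import Data.List.Relation.Unary.All as All
import Data.List.Relation.Unary.All.Properties as All
open import Data.List.Relation.Unary.Any using (here; there; any?)
import Data.List.Relation.Unary.Any as Any
open import Data.List.Relation.Unary.AllPairs using (AllPairs; []; _∷_)
import Data.List.Relation.Unary.AllPairs as AllPairs
import Data.List.Relation.Unary.AllPairs.Properties as AllPairs
open import Data.List.Relation.Unary.Unique.Propositional using (Unique)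
open import Data.List.Membership.Propositional using (_∈_; find)
open import Data.List.Membership.Propositional.Properties
  using (∈-++⁺ˡ; ∈-++⁺ʳ; ∈-filter⁺; ∈-filter⁻; ∈-applyUpTo⁺; ∈-applyUpTo⁻)
open import Data.List.Relation.Binary.Subset.Propositional using (_⊆_)
open import Data.Product using (Σ; ∃; _×_; _,_; proj₁; proj₂; uncurry)
open import Data.Sum using (_⊎_; inj₁; inj₂; [_,_])
open import Data.Empty using (⊥)
open import Function using (id)
open import Relation.Nullary using (¬_; yes; no; contradiction; ¬?)
open import Relation.Binary.Definitions using (DecidableEquality)
open import Relation.Binary.PropositionalEquality
  using (_≡_; _≢_; refl; sym; trans; cong; cong₂; subst; subst₂)

minL-∈ : ∀ x xs → minL (x ∷ xs) ∈ x ∷ xs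
minL-∈ x []       = here refl
minL-∈ x (y ∷ ys) with minL-∈ (x ⊓ y) ys | ⊓-sel x y
... | there p | _        = there (there p)
... | here eq | inj₁ eq′ = here (trans eq eq′)
... | here eq | inj₂ eq′ = there (here (trans eq eq′))

maxL-∈ : ∀ x xs → maxL (x ∷ xs) ∈ x ∷ xs
maxL-∈ x []       = here refl
maxL-∈ x (y ∷ ys) with maxL-∈ (x ⊔ y) ys | ⊔-sel x y
... | there p | _        = there (there p)
... | here eq | inj₁ eq′ = here (trans eq eq′)
... | here eq | inj₂ eq′ = there (here (trans eq eq′))

∈⇒minL≤ : ∀ {z} x xs → z ∈ x ∷ xs → minL (x ∷ xs) ≤ z
∈⇒minL≤ x []       (here refl)         = ≤-refl
∈⇒minL≤ x (y ∷ ys) (here refl)         = ≤-trans (∈⇒minL≤ (x ⊓ y) ys (here refl)) (m⊓n≤m x y)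
∈⇒minL≤ x (y ∷ ys) (there (here refl)) = ≤-trans (∈⇒minL≤ (x ⊓ y) ys (here refl)) (m⊓n≤n x y)
∈⇒minL≤ x (y ∷ ys) (there (there p))   = ∈⇒minL≤ (x ⊓ y) ys (there p)

∈⇒≤maxL : ∀ {z} x xs → z ∈ x ∷ xs → z ≤ maxL (x ∷ xs)
∈⇒≤maxL x []       (here refl)         = ≤-refl
∈⇒≤maxL x (y ∷ ys) (here refl)         = ≤-trans (m≤m⊔n x y) (∈⇒≤maxL (x ⊔ y) ys (here refl))
∈⇒≤maxL x (y ∷ ys) (there (here refl)) = ≤-trans (m≤n⊔m x y) (∈⇒≤maxL (x ⊔ y) ys (here refl))
∈⇒≤maxL x (y ∷ ys) (there (there p))   = ∈⇒≤maxL (x ⊔ y) ys (there p)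

∸≤diam : ∀ {L y z} → y ∈ L → z ∈ L → z ∸ y ≤ diam L
∸≤diam {x ∷ xs} y∈ z∈ = ∸-mono (∈⇒≤maxL x xs z∈) (∈⇒minL≤ x xs y∈)

diam≤∸ : ∀ {lo hi L} → All (λ z → lo ≤ z × z ≤ hi) L → diam L ≤ hi ∸ lo
diam≤∸ {L = []}     _      = z≤n
diam≤∸ {L = x ∷ xs} bounds =
  ∸-mono (proj₂ (All.lookup bounds (maxL-∈ x xs))) (proj₁ (All.lookup bounds (minL-∈ x xs)))

Unique∧⊆⇒length≤ : ∀ {a} {A : Set a} → DecidableEquality A →
                   {xs ys : List A} → Unique xs → xs ⊆ ys → length xs ≤ length ys
Unique∧⊆⇒length≤ _≟_ {[]}     _          _       = z≤n
Unique∧⊆⇒length≤ _≟_ {x ∷ xs} {ys} (x∉xs ∷ u) x∷xs⊆ys =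
  ≤-trans (s≤s (Unique∧⊆⇒length≤ _≟_ u xs⊆ys-x))
          (filter-notAll ≢x? ys (Any.map ¬¬≡x (x∷xs⊆ys (here refl))))
  where
  ≢x? = λ z → ¬? (z ≟ x)
  ¬¬≡x : ∀ {z} → x ≡ z → ¬ (z ≢ x)
  ¬¬≡x x≡z z≢x = z≢x (sym x≡z)
  xs⊆ys-x : xs ⊆ filter ≢x? ys
  xs⊆ys-x z∈xs = ∈-filter⁺ ≢x? (x∷xs⊆ys (there z∈xs)) (λ z≡x → All.lookup x∉xs z∈xs (sym z≡x))

interval : ℕ → ℕ → List ℕ
interval lo hi = applyUpTo (lo +_) (suc hi ∸ lo)

length-interval : ∀ lo hi → length (interval lo hi) ≡ suc hi ∸ lo
length-interval lo hi = length-applyUpTo (lo +_) (suc hi ∸ lo)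

interval-sorted : ∀ lo hi → AllPairs _<_ (interval lo hi)
interval-sorted lo hi = AllPairs.applyUpTo⁺₁ (lo +_) (suc hi ∸ lo) (λ i<j _ → +-monoʳ-< lo i<j)

∈-interval⁺ : ∀ {lo hi z} → lo ≤ z → z ≤ hi → z ∈ interval lo hi
∈-interval⁺ {lo} {hi} lo≤z z≤hi =
  subst (_∈ interval lo hi) (m+[n∸m]≡n lo≤z) (∈-applyUpTo⁺ (lo +_) (∸-monoˡ-< (s≤s z≤hi) lo≤z))

∈-interval⁻ : ∀ {lo hi z} → z ∈ interval lo hi → lo ≤ z × z ≤ hi
∈-interval⁻ {lo} {hi} z∈ with i , i< , refl ← ∈-applyUpTo⁻ (lo +_) z∈ =
  m≤m+n lo i ,
  s≤s⁻¹ (subst (_≤ suc hi) (trans (+-comm (suc i) lo) (+-suc lo i)) (m≤o∸n⇒m+n≤o (suc i) lo≤1+hi i<))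
  where
  lo≤1+hi : lo ≤ suc hi
  lo≤1+hi = <⇒≤ (m∸n≢0⇒n<m (λ eq → contradiction (subst (suc i ≤_) eq i<) λ ()))

Unique∧bounded⇒length≤ : ∀ {lo hi S} → Unique S → All (λ z → lo ≤ z × z ≤ hi) S →
                         length S ≤ suc hi ∸ lo
Unique∧bounded⇒length≤ {lo} {hi} u bounds =
  ≤-trans (Unique∧⊆⇒length≤ _≟_ u (λ z∈S → uncurry ∈-interval⁺ (All.lookup bounds z∈S)))
          (≤-reflexive (length-interval lo hi))

Unique∧bounded⇒length+lo≤ : ∀ {lo hi x xs} → Unique (x ∷ xs) →
                            All (λ z → lo ≤ z × z ≤ hi) (x ∷ xs) → length (x ∷ xs) + lo ≤ suc hi
Unique∧bounded⇒length+lo≤ u bounds@((lo≤x , x≤hi) ∷ _) =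
  m≤o∸n⇒m+n≤o _ (≤-trans lo≤x (m≤n⇒m≤1+n x≤hi)) (Unique∧bounded⇒length≤ u bounds)

length≤1+diam : ∀ {L} → Unique L → length L ≤ suc (diam L)
length≤1+diam {[]}     _ = z≤n
length≤1+diam {x ∷ xs} u =
  subst (length (x ∷ xs) ≤_) (+-∸-assoc 1 min≤max)
    (Unique∧bounded⇒length≤ u (All.tabulate λ z∈ → ∈⇒minL≤ x xs z∈ , ∈⇒≤maxL x xs z∈))
  where
  min≤max : minL (x ∷ xs) ≤ maxL (x ∷ xs)
  min≤max = ≤-trans (∈⇒minL≤ x xs (here refl)) (∈⇒≤maxL x xs (here refl))

drop-reaches : ∀ n {xs z} → AllPairs _<_ xs → n < length xs → z ∈ xs →
               ∃ λ w → w ∈ drop n xs × z ≤ w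
drop-reaches zero    {z = z} _ _ z∈ = z , z∈ , ≤-refl
drop-reaches (suc n) {y ∷ []}      _             (s≤s ()) (here refl)
drop-reaches (suc n) {y ∷ y′ ∷ ys} (y< ∷ sorted) (s≤s n<) (here refl) =
  let w , w∈ , y′≤w = drop-reaches n sorted n< (here refl)
  in  w , w∈ , ≤-trans (<⇒≤ (All.head y<)) y′≤w
drop-reaches (suc n) {y ∷ ys} (_ ∷ sorted) (s≤s n<) (there z∈) = drop-reaches n sorted n< z∈

spanningSublist : ∀ {P : ℕ → Set} {L m} → AllPairs _<_ L → All P L → 2 ≤ m → m ≤ length L →
                  ∃ λ S → AllPairs _<_ S × All P S × length S ≡ m × diam L ≤ diam S
spanningSublist {L = x ∷ xs} {suc m} (x< ∷ sorted) (px ∷ pxs) (s≤s 1≤m) (s≤s m≤) =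
  x ∷ drop n xs , (All.drop⁺ n x< ∷ AllPairs.drop⁺ n sorted) , px ∷ All.drop⁺ n pxs ,
  cong suc (trans (length-drop n xs) (m∸[m∸n]≡n m≤)) , diam≤
  where
  n = length xs ∸ m
  x≤minL : x ≤ minL (x ∷ xs)
  x≤minL = All.lookup (≤-refl ∷ All.map <⇒≤ x<) (minL-∈ x xs)
  diam≤ : diam (x ∷ xs) ≤ diam (x ∷ drop n xs)
  diam≤ with w , w∈ , max≤w ←
    drop-reaches (suc n) (x< ∷ sorted) (s≤s (∸-monoʳ-< 1≤m m≤)) (maxL-∈ x xs) =
    ≤-trans (∸-mono max≤w x≤minL) (∸≤diam (here refl) (there w∈))

MonoIn : ∀ {k} → (ℕ → Fin k) → ℕ → ℕ → ℕ → List ℕ → Set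
MonoIn Δ lo hi m S = Unique S × All (λ z → lo ≤ z × z ≤ hi) S × length S ≡ m × Monochromatic Δ S

Pattern : ∀ {k} → (ℕ → Fin k) → ℕ → ℕ → ℕ → Set
Pattern Δ s r n = Σ (List ℕ) λ S₁ → Σ (List ℕ) λ S₂ →
  GoodSet Δ n s S₁ × GoodSet Δ n r S₂ × maxL S₁ < minL S₂ × diam S₁ ≤ diam S₂

module _ {k} {Δ : ℕ → Fin k} where

  sorted⇒MonoIn : ∀ {c lo hi m S} → AllPairs _<_ S → All (λ z → (lo ≤ z × z ≤ hi) × Δ z ≡ c) S →
                  length S ≡ m → MonoIn Δ lo hi m S
  sorted⇒MonoIn {c} sorted inClass len =
    AllPairs.map <⇒≢ sorted , All.map proj₁ inClass , len , c , All.map proj₂ inClass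

  MonoIn-weaken : ∀ {lo lo′ hi hi′ m S} → lo′ ≤ lo → hi ≤ hi′ →
                  MonoIn Δ lo hi m S → MonoIn Δ lo′ hi′ m S
  MonoIn-weaken lo′≤lo hi≤hi′ (u , bounds , len , mono) =
    u , All.map (λ (lo≤z , z≤hi) → ≤-trans lo′≤lo lo≤z , ≤-trans z≤hi hi≤hi′) bounds , len , mono

  separated⇒Pattern : ∀ {n s r lo₁ hi₁ lo₂ hi₂ S₁ S₂} →
                      1 ≤ s → 1 ≤ r → 1 ≤ lo₁ → hi₁ < lo₂ → hi₂ ≤ n →
                      MonoIn Δ lo₁ hi₁ s S₁ → MonoIn Δ lo₂ hi₂ r S₂ → diam S₁ ≤ diam S₂ →
                      Pattern Δ s r n
  separated⇒Pattern {S₁ = []} 1≤s _ _ _ _ (_ , _ , len , _) _ _ = contradiction (subst (1 ≤_) (sym len) 1≤s) λ ()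
  separated⇒Pattern {S₂ = []} _ 1≤r _ _ _ _ (_ , _ , len , _) _ = contradiction (subst (1 ≤_) (sym len) 1≤r) λ ()
  separated⇒Pattern {n} {hi₁ = hi₁} {S₁ = x ∷ xs} {y ∷ ys} _ _ 1≤lo₁ hi₁<lo₂ hi₂≤n
                    M₁@(_ , bounds₁ , _) M₂@(_ , bounds₂ , _) diam≤ =
    x ∷ xs , y ∷ ys ,
    MonoIn-weaken 1≤lo₁ hi₁≤n M₁ , MonoIn-weaken (≤-trans (s≤s z≤n) hi₁<lo₂) hi₂≤n M₂ ,
    ≤-trans (s≤s (proj₂ (All.lookup bounds₁ (maxL-∈ x xs))))
            (≤-trans hi₁<lo₂ (proj₁ (All.lookup bounds₂ (minL-∈ y ys)))) ,
    diam≤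
    where
    hi₁≤n : hi₁ ≤ n
    hi₁≤n = let lo₂≤y , y≤hi₂ = All.head bounds₂ in
      ≤-trans (<⇒≤ hi₁<lo₂) (≤-trans lo₂≤y (≤-trans y≤hi₂ hi₂≤n))

colourClass : ∀ {k} → (ℕ → Fin k) → Fin k → ℕ → ℕ → List ℕ
colourClass Δ c lo hi = filter (λ z → Δ z ≟ᶠ c) (interval lo hi)

module _ {k} (Δ : ℕ → Fin k) (c : Fin k) (lo hi : ℕ) where

  colourClass-sorted : AllPairs _<_ (colourClass Δ c lo hi)
  colourClass-sorted = AllPairs.filter⁺ (λ z → Δ z ≟ᶠ c) (interval-sorted lo hi)

  colourClass-unique : Unique (colourClass Δ c lo hi)
  colourClass-unique = AllPairs.map <⇒≢ colourClass-sorted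

  ∈-colourClass⁺ : ∀ {z} → lo ≤ z → z ≤ hi → Δ z ≡ c → z ∈ colourClass Δ c lo hi
  ∈-colourClass⁺ lo≤z z≤hi = ∈-filter⁺ (λ z → Δ z ≟ᶠ c) (∈-interval⁺ lo≤z z≤hi)

  colourClass-all : All (λ z → (lo ≤ z × z ≤ hi) × Δ z ≡ c) (colourClass Δ c lo hi)
  colourClass-all = All.tabulate λ z∈ →
    let z∈I , Δz≡c = ∈-filter⁻ (λ z → Δ z ≟ᶠ c) z∈ in ∈-interval⁻ z∈I , Δz≡c

  colourClass-take : ∀ {m} → m ≤ length (colourClass Δ c lo hi) →
                     MonoIn Δ lo hi m (take m (colourClass Δ c lo hi))
  colourClass-take {m} m≤len =
    sorted⇒MonoIn (AllPairs.take⁺ m colourClass-sorted) (All.take⁺ m colourClass-all)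
      (trans (length-take m _) (m≤n⇒m⊓n≡m m≤len))

≢⇒≡opposite : ∀ {c d : Fin 2} → d ≢ c → d ≡ opposite c
≢⇒≡opposite {zero}     {zero}     d≢c = contradiction refl d≢c
≢⇒≡opposite {zero}     {suc zero} _   = refl
≢⇒≡opposite {suc zero} {zero}     _   = refl
≢⇒≡opposite {suc zero} {suc zero} d≢c = contradiction refl d≢c

length-filter-colour+opposite : (Δ : ℕ → Fin 2) (c : Fin 2) (xs : List ℕ) →
  length (filter (λ z → Δ z ≟ᶠ c) xs) + length (filter (λ z → Δ z ≟ᶠ opposite c) xs) ≡ length xs
length-filter-colour+opposite Δ c [] = refl
length-filter-colour+opposite Δ c (x ∷ xs) with Δ x | length-filter-colour+opposite Δ c xs
length-filter-colour+opposite Δ zero       (x ∷ xs) | zero     | ih = cong suc ih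
length-filter-colour+opposite Δ zero       (x ∷ xs) | suc zero | ih = trans (+-suc _ _) (cong suc ih)
length-filter-colour+opposite Δ (suc zero) (x ∷ xs) | zero     | ih = trans (+-suc _ _) (cong suc ih)
length-filter-colour+opposite Δ (suc zero) (x ∷ xs) | suc zero | ih = cong suc ih

colourClass-pigeonhole : (Δ : ℕ → Fin 2) (c : Fin 2) (lo hi : ℕ) {p q : ℕ} →
  p + q ≤ suc (suc hi ∸ lo) →
  p ≤ length (colourClass Δ c lo hi) ⊎ q ≤ length (colourClass Δ (opposite c) lo hi)
colourClass-pigeonhole Δ c lo hi {p} {q} p+q≤
  with p ≤? length (colourClass Δ c lo hi) | q ≤? length (colourClass Δ (opposite c) lo hi)
... | yes p≤ | _      = inj₁ p≤
... | no _   | yes q≤ = inj₂ q≤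
... | no p≰  | no q≰  =
  contradiction (subst (_≤ suc (suc hi ∸ lo)) size≡ (≤-trans (+-mono-≤ (≰⇒> p≰) (≰⇒> q≰)) p+q≤))
                (<-irrefl refl)
  where
  a = length (colourClass Δ c lo hi)
  b = length (colourClass Δ (opposite c) lo hi)
  size≡ : suc a + suc b ≡ suc (suc (suc hi ∸ lo))
  size≡ = cong suc (trans (+-suc a b)
    (cong suc (trans (length-filter-colour+opposite Δ c (interval lo hi)) (length-interval lo hi))))

monochromaticSubset : (Δ : ℕ → Fin 2) (lo hi : ℕ) {p : ℕ} → p + p ≤ suc (suc hi ∸ lo) →
                      ∃ λ S → MonoIn Δ lo hi p S
monochromaticSubset Δ lo hi p+p≤ with colourClass-pigeonhole Δ zero lo hi p+p≤
... | inj₁ p≤len = _ , colourClass-take Δ zero lo hi p≤len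
... | inj₂ p≤len = _ , colourClass-take Δ (suc zero) lo hi p≤len

module UpperBound (Δ : ℕ → Fin 2) {k r : ℕ} (1≤k : 1 ≤ k) (k<r : k < r) (r≤1+2k : r ≤ suc (2 * k)) where

  N lo₂ g : ℕ
  N   = suc (2 * k) + (2 * k + r)
  lo₂ = suc (suc (2 * k))
  -- g = N − 2k: a point y ≤ g spans a diameter ≥ 2k together with N.
  g   = suc (2 * k) + r

  1≤r : 1 ≤ r
  1≤r = ≤-trans (s≤s z≤n) k<r

  lo₂≤g : lo₂ ≤ g
  lo₂≤g = s≤s (m<m+n (2 * k) 1≤r)

  g≤N : g ≤ N
  g≤N = +-monoʳ-≤ (suc (2 * k)) (m≤n+m r (2 * k))

  blockSize : r + suc (2 * k) ≡ suc (suc N ∸ lo₂)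
  blockSize = begin-equality
    r + suc (2 * k)                    ≡⟨ +-suc r (2 * k) ⟩
    suc (r + 2 * k)                    ≡⟨ cong suc (+-comm r (2 * k)) ⟩
    suc (2 * k + r)                    ≡⟨ cong suc (m+n∸m≡n (2 * k) (2 * k + r)) ⟨
    suc (2 * k + (2 * k + r) ∸ 2 * k)  ∎
    where open ≤-Reasoning

  firstBlock : ∃ λ S → MonoIn Δ 1 (suc (2 * k)) (suc k) S
  firstBlock = monochromaticSubset Δ 1 (suc (2 * k)) (≤-reflexive (double-suc k))
    where
    double-suc : ∀ k → suc k + suc k ≡ suc (suc (2 * k))
    double-suc = solve-∀

  spreadClass⇒Pattern : ∀ c → r ≤ length (colourClass Δ c lo₂ N) → 2 * k ≤ diam (colourClass Δ c lo₂ N) →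
                        Pattern Δ (suc k) r N
  spreadClass⇒Pattern c r≤len 2k≤diam
    with S₁ , M₁@(_ , bounds₁ , _) ← firstBlock
       | S₂ , sorted , inClass , len , spread ←
           spanningSublist (colourClass-sorted Δ c lo₂ N) (colourClass-all Δ c lo₂ N)
                           (≤-trans (s≤s 1≤k) k<r) r≤len =
    separated⇒Pattern (s≤s z≤n) 1≤r ≤-refl ≤-refl ≤-refl M₁ (sorted⇒MonoIn sorted inClass len)
      (≤-trans (diam≤∸ bounds₁) (≤-trans 2k≤diam spread))

  gap⇒Pattern : ∀ c → r ≤ length (colourClass Δ c lo₂ N) → All (g <_) (colourClass Δ c lo₂ N) →
                Pattern Δ (suc k) r N
  gap⇒Pattern c r≤len gap = separated⇒Pattern (s≤s z≤n) 1≤r (s≤s z≤n) (s≤s hi₁≤g) ≤-refl M₁ M₂ diam≤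
    where
    hi₁ : ℕ
    hi₁ = lo₂ + k
    hi₁≤g : hi₁ ≤ g
    hi₁≤g = s≤s (subst (_≤ 2 * k + r) (+-suc (2 * k) k) (+-monoʳ-≤ (2 * k) k<r))
    opposite-on-gap : ∀ {z} → lo₂ ≤ z × z ≤ hi₁ → Δ z ≡ opposite c
    opposite-on-gap (lo₂≤z , z≤hi₁) = ≢⇒≡opposite λ Δz≡c →
      let z≤g = ≤-trans z≤hi₁ hi₁≤g in
      <⇒≱ (All.lookup gap (∈-colourClass⁺ Δ c lo₂ N lo₂≤z (≤-trans z≤g g≤N) Δz≡c)) z≤g
    M₁ : MonoIn Δ lo₂ hi₁ (suc k) (interval lo₂ hi₁)
    M₁ = sorted⇒MonoIn (interval-sorted lo₂ hi₁)
           (All.tabulate λ z∈ → ∈-interval⁻ z∈ , opposite-on-gap (∈-interval⁻ z∈))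
           (trans (length-interval lo₂ hi₁)
                  (trans (cong (_∸ lo₂) (sym (+-suc lo₂ k))) (m+n∸m≡n lo₂ (suc k))))
    S₂ : List ℕ
    S₂ = take r (colourClass Δ c lo₂ N)
    len₂ : length S₂ ≡ r
    len₂ = trans (length-take r _) (m≤n⇒m⊓n≡m r≤len)
    M₂ : MonoIn Δ (suc g) N r S₂
    M₂ = sorted⇒MonoIn (AllPairs.take⁺ r (colourClass-sorted Δ c lo₂ N))
           (All.take⁺ r (All.zipWith (λ (((_ , z≤N) , Δz≡c) , g<z) → (g<z , z≤N) , Δz≡c)
                                     (colourClass-all Δ c lo₂ N , gap)))
           len₂
    diam≤ : diam (interval lo₂ hi₁) ≤ diam S₂
    diam≤ = begin
      diam (interval lo₂ hi₁)  ≤⟨ diam≤∸ {lo₂} {hi₁} (All.tabulate ∈-interval⁻) ⟩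
      hi₁ ∸ lo₂                ≡⟨ m+n∸m≡n lo₂ k ⟩
      k                        ≤⟨ s≤s⁻¹ (≤-trans k<r (subst (_≤ suc (diam S₂)) len₂ (length≤1+diam (proj₁ M₂)))) ⟩
      diam S₂                  ∎
      where open ≤-Reasoning

  early⇒spread : ∀ {y} → y ∈ colourClass Δ (Δ N) lo₂ N → y ≤ g →
                 2 * k ≤ diam (colourClass Δ (Δ N) lo₂ N)
  early⇒spread {y} y∈ y≤g = begin
    2 * k          ≡⟨ m+n∸m≡n g (2 * k) ⟨
    g + 2 * k ∸ g  ≡⟨ cong (_∸ g) g+2k≡N ⟩
    N ∸ g          ≤⟨ ∸-monoʳ-≤ N y≤g ⟩
    N ∸ y          ≤⟨ ∸≤diam y∈ (∈-colourClass⁺ Δ (Δ N) lo₂ N (≤-trans lo₂≤g g≤N) ≤-refl refl) ⟩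
    diam (colourClass Δ (Δ N) lo₂ N) ∎
    where
    open ≤-Reasoning
    g+2k≡N : g + 2 * k ≡ N
    g+2k≡N = trans (+-assoc (suc (2 * k)) r (2 * k)) (cong (suc (2 * k) +_) (+-comm r (2 * k)))

  upperBound : Pattern Δ (suc k) r N
  upperBound with colourClass-pigeonhole Δ (Δ N) lo₂ N {r} {suc (2 * k)} (≤-reflexive blockSize)
  ... | inj₂ 1+2k≤len = spreadClass⇒Pattern (opposite (Δ N)) (≤-trans r≤1+2k 1+2k≤len)
    (s≤s⁻¹ (≤-trans 1+2k≤len (length≤1+diam (colourClass-unique Δ (opposite (Δ N)) lo₂ N))))
  ... | inj₁ r≤len with any? (_≤? g) (colourClass Δ (Δ N) lo₂ N)
  ...   | no  none  = gap⇒Pattern (Δ N) r≤len (All.map ≰⇒> (All.¬Any⇒All¬ _ none))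
  ...   | yes early = let _ , y∈ , y≤g = find early in spreadClass⇒Pattern (Δ N) r≤len (early⇒spread y∈ y≤g)

pattern red  = zero
pattern blue = suc zero

lowerColouring : ℕ → ℕ → Fin 2
lowerColouring k z with z ≤? k | z ≤? 2 * k | z ≤? suc (2 * k + 2 * k)
... | yes _ | _     | _     = red
... | no _  | yes _ | _     = blue
... | no _  | no _  | yes _ = red
... | no _  | no _  | no _  = blue

red-blocks : ∀ k z → lowerColouring k z ≡ red → z ≤ k ⊎ (2 * k < z × z ≤ suc (2 * k + 2 * k))
red-blocks k z red≡ with z ≤? k | z ≤? 2 * k | z ≤? suc (2 * k + 2 * k)
red-blocks k z refl | yes z≤k | _      | _       = inj₁ z≤k
red-blocks k z ()   | no _    | yes _  | _
red-blocks k z refl | no _    | no z≰A | yes z≤e = inj₂ (≰⇒> z≰A , z≤e)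
red-blocks k z ()   | no _    | no _   | no _

blue-blocks : ∀ k z → lowerColouring k z ≡ blue → (k < z × z ≤ 2 * k) ⊎ suc (2 * k + 2 * k) < z
blue-blocks k z blue≡ with z ≤? k | z ≤? 2 * k | z ≤? suc (2 * k + 2 * k)
blue-blocks k z ()   | yes _  | _       | _
blue-blocks k z refl | no z≰k | yes z≤A | _       = inj₁ (≰⇒> z≰k , z≤A)
blue-blocks k z ()   | no _   | no _    | yes _
blue-blocks k z refl | no _   | no _    | no z≰e = inj₂ (≰⇒> z≰e)

module LowerBound {k r m : ℕ} (k<r : k < r) (m≤M : m ≤ 2 * k + (2 * k + r)) where

  A e : ℕ
  A = 2 * k
  e = suc (A + A)

  C : ℕ → Fin 2
  C = lowerColouring k

  A≤e : A ≤ e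
  A≤e = m≤n⇒m≤1+n (m≤m+n A A)

  red∧≤A⇒≤k : ∀ {z} → C z ≡ red → z ≤ A → z ≤ k
  red∧≤A⇒≤k {z} Cz≡ z≤A = [ id , (λ (A<z , _) → contradiction z≤A (<⇒≱ A<z)) ] (red-blocks k z Cz≡)

  red∧>A⇒≤e : ∀ {z} → C z ≡ red → A < z → z ≤ e
  red∧>A⇒≤e {z} Cz≡ A<z =
    [ (λ z≤k → contradiction (≤-trans z≤k (m≤m+n k (k + 0))) (<⇒≱ A<z)) , proj₂ ] (red-blocks k z Cz≡)

  blue∧≤A⇒>k : ∀ {z} → C z ≡ blue → z ≤ A → k < z
  blue∧≤A⇒>k {z} Cz≡ z≤A =
    [ proj₁ , (λ e<z → contradiction (≤-trans z≤A A≤e) (<⇒≱ e<z)) ] (blue-blocks k z Cz≡)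

  blue∧>A⇒>e : ∀ {z} → C z ≡ blue → A < z → e < z
  blue∧>A⇒>e {z} Cz≡ A<z = [ (λ (_ , z≤A) → contradiction z≤A (<⇒≱ A<z)) , id ] (blue-blocks k z Cz≡)

  monochromatic≤A⇒length≤k : ∀ {c S} → Unique S → All (λ z → 1 ≤ z × z ≤ A) S →
                             All (λ z → C z ≡ c) S → length S ≤ k
  monochromatic≤A⇒length≤k {red} u bounds mono =
    Unique∧bounded⇒length≤ u
      (All.zipWith (λ ((1≤z , z≤A) , Cz≡) → 1≤z , red∧≤A⇒≤k Cz≡ z≤A) (bounds , mono))
  monochromatic≤A⇒length≤k {blue} {S} u bounds mono =
    subst (length S ≤_) (trans (m+n∸m≡n k (k + 0)) (+-identityʳ k))
      (Unique∧bounded⇒length≤ u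
        (All.zipWith (λ ((_ , z≤A) , Cz≡) → blue∧≤A⇒>k Cz≡ z≤A , z≤A) (bounds , mono)))

  module Refutation {x₁ x₂ : ℕ} {xs₁ xs₂ : List ℕ} {c₁ c₂ : Fin 2}
           (u₁ : Unique (x₁ ∷ xs₁)) (b₁ : All (λ z → 1 ≤ z × z ≤ m) (x₁ ∷ xs₁))
           (len₁ : length (x₁ ∷ xs₁) ≡ suc k) (mono₁ : All (λ z → C z ≡ c₁) (x₁ ∷ xs₁))
           (u₂ : Unique (x₂ ∷ xs₂)) (b₂ : All (λ z → 1 ≤ z × z ≤ m) (x₂ ∷ xs₂))
           (len₂ : length (x₂ ∷ xs₂) ≡ r) (mono₂ : All (λ z → C z ≡ c₂) (x₂ ∷ xs₂))
           (separated : maxL (x₁ ∷ xs₁) < minL (x₂ ∷ xs₂)) where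

    S₁ S₂ : List ℕ
    S₁ = x₁ ∷ xs₁
    S₂ = x₂ ∷ xs₂

    a : ℕ
    a = maxL S₁

    A<a : A < a
    A<a with A <? a
    ... | yes A<a = A<a
    ... | no  A≮a = contradiction (subst (_≤ k) len₁ (monochromatic≤A⇒length≤k u₁ S₁≤A mono₁)) 1+n≰n
      where
      S₁≤A : All (λ z → 1 ≤ z × z ≤ A) S₁
      S₁≤A = All.zipWith (λ ((1≤z , _) , z≤a) → 1≤z , ≤-trans z≤a (≮⇒≥ A≮a))
                         (b₁ , All.tabulate (∈⇒≤maxL x₁ xs₁))

    S₂-above-a : All (λ z → a < z × z ≤ m) S₂
    S₂-above-a = All.tabulate λ z∈ → ≤-trans separated (∈⇒minL≤ x₂ xs₂ z∈) , proj₂ (All.lookup b₂ z∈)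

    S₂-red : ∀ {c} → All (λ z → C z ≡ c) S₂ → All (λ z → C z ≡ red) S₂
    S₂-red {red}  mono = mono
    S₂-red {blue} mono = contradiction (subst (_≤ suc (A + (A + r))) (r+2+[A+A]≡2+[A+[A+r]] r A)
      (≤-trans count (s≤s m≤M))) 1+n≰n
      where
      S₂-in-B₂ : All (λ z → suc e ≤ z × z ≤ m) S₂
      S₂-in-B₂ = All.zipWith (λ ((a<z , z≤m) , Cz≡) → blue∧>A⇒>e Cz≡ (<-trans A<a a<z) , z≤m)
                             (S₂-above-a , mono)
      count : r + suc e ≤ suc m
      count = subst (λ l → l + suc e ≤ suc m) len₂ (Unique∧bounded⇒length+lo≤ u₂ S₂-in-B₂)
      r+2+[A+A]≡2+[A+[A+r]] : ∀ r A → r + suc (suc (A + A)) ≡ suc (suc (A + (A + r)))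
      r+2+[A+A]≡2+[A+[A+r]] = solve-∀

    S₂-in-R₂ : All (λ z → a < z × z ≤ e) S₂
    S₂-in-R₂ = All.zipWith (λ ((a<z , _) , Cz≡) → a<z , red∧>A⇒≤e Cz≡ (<-trans A<a a<z))
                           (S₂-above-a , S₂-red mono₂)

    a<e : a < e
    a<e = let a<x₂ , x₂≤e = All.head S₂-in-R₂ in ≤-trans a<x₂ x₂≤e

    S₁-red : ∀ {c} → All (λ z → C z ≡ c) S₁ → All (λ z → C z ≡ red) S₁
    S₁-red {red}  mono = mono
    S₁-red {blue} mono = contradiction (blue∧>A⇒>e (All.lookup mono (maxL-∈ x₁ xs₁)) A<a) (<-asym a<e)

    diam₂<A : diam S₂ < A
    diam₂<A = begin-strict
      diam S₂       ≤⟨ diam≤∸ S₂-in-R₂ ⟩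
      (A + A) ∸ a   <⟨ ∸-monoʳ-< A<a (s≤s⁻¹ a<e) ⟩
      (A + A) ∸ A   ≡⟨ m+n∸n≡m A A ⟩
      A             ∎
      where open ≤-Reasoning

    A≤diam₁ : minL S₁ ≤ k → A ≤ diam S₁
    A≤diam₁ min≤k = m+n≤o⇒m≤o∸n A (subst (_≤ a) (+-comm mn A) mn+A≤a)
      where
      mn p q : ℕ
      mn = minL S₁
      p  = suc k ∸ mn
      q  = a ∸ A
      S₁⊆ : S₁ ⊆ interval mn k ++ interval (suc A) a
      S₁⊆ z∈ with red-blocks k _ (All.lookup (S₁-red mono₁) z∈)
      ... | inj₁ z≤k       = ∈-++⁺ˡ (∈-interval⁺ (∈⇒minL≤ x₁ xs₁ z∈) z≤k)
      ... | inj₂ (A<z , _) = ∈-++⁺ʳ (interval mn k) (∈-interval⁺ A<z (∈⇒≤maxL x₁ xs₁ z∈))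
      count : suc k ≤ p + q
      count = subst₂ _≤_ len₁
        (trans (length-++ (interval mn k)) (cong₂ _+_ (length-interval mn k) (length-interval (suc A) a)))
        (Unique∧⊆⇒length≤ _≟_ u₁ S₁⊆)
      mn+A≤a : mn + A ≤ a
      mn+A≤a = m≤o∸n⇒m+n≤o mn (<⇒≤ A<a) (+-cancelˡ-≤ (suc k) mn q (begin
        suc k + mn  ≤⟨ +-monoˡ-≤ mn count ⟩
        p + q + mn  ≡⟨ trans (+-assoc p q mn) (trans (cong (p +_) (+-comm q mn)) (sym (+-assoc p mn q))) ⟩
        p + mn + q  ≡⟨ cong (_+ q) (m∸n+n≡m (m≤n⇒m≤1+n min≤k)) ⟩
        suc k + q   ∎))
        where open ≤-Reasoning

    r≤k : k < minL S₁ → r ≤ k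
    r≤k k<min = +-cancelʳ-≤ k r k (+-cancelʳ-≤ A (r + k) (k + k) (s≤s⁻¹ (s≤s⁻¹ (begin
      suc (suc (r + k + A))  ≡⟨ r+[1+k+1+A]≡2+[r+k+A] r k A ⟨
      r + (suc k + suc A)    ≤⟨ +-monoʳ-≤ r count ⟩
      r + suc a              ≤⟨ r+a<e ⟩
      suc e                  ≡⟨ cong (λ t → suc (suc t)) (A+A≡k+k+A k) ⟩
      suc (suc (k + k + A))  ∎))))
      where
      open ≤-Reasoning
      S₁-in-R₂ : All (λ z → suc A ≤ z × z ≤ a) S₁
      S₁-in-R₂ = All.tabulate λ z∈ →
        [ (λ z≤k → contradiction (≤-trans (∈⇒minL≤ x₁ xs₁ z∈) z≤k) (<⇒≱ k<min)) , proj₁ ]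
          (red-blocks k _ (All.lookup (S₁-red mono₁) z∈)) ,
        ∈⇒≤maxL x₁ xs₁ z∈
      count : suc k + suc A ≤ suc a
      count = subst (λ l → l + suc A ≤ suc a) len₁ (Unique∧bounded⇒length+lo≤ u₁ S₁-in-R₂)
      r+a<e : r + suc a ≤ suc e
      r+a<e = subst (λ l → l + suc a ≤ suc e) len₂ (Unique∧bounded⇒length+lo≤ u₂ S₂-in-R₂)
      r+[1+k+1+A]≡2+[r+k+A] : ∀ r k A → r + (suc k + suc A) ≡ suc (suc (r + k + A))
      r+[1+k+1+A]≡2+[r+k+A] = solve-∀
      A+A≡k+k+A : ∀ k → 2 * k + 2 * k ≡ k + k + 2 * k
      A+A≡k+k+A = solve-∀

    refuted : diam S₁ ≤ diam S₂ → ⊥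
    refuted diam≤ with minL S₁ ≤? k
    ... | yes min≤k = <⇒≱ diam₂<A (≤-trans (A≤diam₁ min≤k) diam≤)
    ... | no  min≰k = <⇒≱ k<r (r≤k (≰⇒> min≰k))

  noPattern : ¬ Pattern C (suc k) r m
  noPattern ([] , _ , (_ , _ , () , _) , _)
  noPattern (_ ∷ _ , [] , _ , (_ , _ , len₂ , _) , _) = contradiction (subst (k <_) (sym len₂) k<r) λ ()
  noPattern (_ ∷ _ , _ ∷ _ , (u₁ , b₁ , len₁ , _ , mono₁) , (u₂ , b₂ , len₂ , _ , mono₂) ,
             separated , diam≤) =
    Refutation.refuted u₁ b₁ len₁ mono₁ u₂ b₂ len₂ mono₂ separated diam≤

theorem3p2 : (s r : ℕ) → 1 ≤ s → 1 ≤ r → s ≤ r → 2 ≤ s → r ≤ 2 * s ∸ 2 →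
    fIs s r 2 (4 * s + r ∸ 3)
theorem3p2 (suc k) r _ _ k<r (s≤s 1≤k) r≤2s∸2 = subst (fIs (suc k) r 2) (sym n≡)
  ( s≤s z≤n
  , (λ Δ → UpperBound.upperBound Δ 1≤k k<r r≤1+2k)
  , (λ m _ m<n hasPattern → LowerBound.noPattern k<r (s≤s⁻¹ m<n) (hasPattern (lowerColouring k))))
  where
  2[1+k]≡2+2k : ∀ k → 2 * suc k ≡ suc (suc (2 * k))
  2[1+k]≡2+2k = solve-∀
  4[1+k]+r≡3+n : ∀ k r → 4 * suc k + r ≡ 3 + (suc (2 * k) + (2 * k + r))
  4[1+k]+r≡3+n = solve-∀
  r≤1+2k : r ≤ suc (2 * k)
  r≤1+2k = m≤n⇒m≤1+n (subst (λ t → r ≤ t ∸ 2) (2[1+k]≡2+2k k) r≤2s∸2)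
  n≡ : 4 * suc k + r ∸ 3 ≡ suc (2 * k) + (2 * k + r)
  n≡ = trans (cong (_∸ 3) (4[1+k]+r≡3+n k r)) (m+n∸m≡n 3 _)
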